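{- Let $G$ be a connected graph with $n$ vertices and $g\ge 0$ an integer such that $\kappa^g(G)$ exists. If $c^g(G)\le \lceil n/2\rceil$, then $t^{g}(G)=c^g(G)-1$.
   Context: For $G=(V,E)$ and $F\subseteq V$, $F$ is a $g$-good-neighbor conditional faulty set if every vertex of $V\setminus F$ has at least $g$ neighbors in $V\setminus F$; it is a $g$-good-neighbor cut if moreover $G-F$ is disconnected. $\kappa^g(G)$ is the minimum size of a $g$-good-neighbor cut (it exists if such a cut exists). PMC model: distinct $F_1,F_2\subseteq V$ are distinguishable iff there exist $u\in F_1\triangle F_2$, $v\in V\setminus(F_1\cup F_2)$ with $uv\in E$. $t^g(G)$ is the maximum $t$ such that every pair of distinct $g$-good-neighbor conditional faulty sets of size at most $t$ is distinguishable. gc number: for a $g$-good-neighbor cut $X$ and component $C$ of $G-X$, $C$ is splittable if $V(C)$ partitions into nonempty $A,B$ with $\delta(G[A]),\delta(G[B])\ge g$; among such partitions with $|A|\ge|B|$ minimizing $|A|-|B|$ set $a(C)=|A|$. $a(X)=\min a(C)$ over splittable components, $c(X)=$ minimum order of a non-splittable component (minima over empty sets are $+\infty$), and $c^g(G)=\min_X\{|X|+\min\{a(X),c(X)\}\}$ over all $g$-good-neighbor cuts $X$. -}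

module Defs where

open import Data.Nat using (ℕ; _≤_; _+_; _∸_)
open import Data.Fin using (Fin)
open import Data.Fin.Subset using (Subset; _∈_; _∉_; _⊆_; _∩_; ∁; ∣_∣; Nonempty)
open import Data.Bool using (Bool; true; false)
open import Data.Vec using (tabulate)
open import Data.Product using (Σ; ∃; ∃-syntax; _×_; _,_)
open import Data.Sum using (_⊎_)
open import Relation.Binary.PropositionalEquality using (_≡_)
open import Relation.Nullary using (¬_)

record Graph (n : ℕ) : Set where
  field
    adj   : Fin n → Fin n → Bool
    sym   : ∀ u v → adj u v ≡ adj v u
    irrefl : ∀ v → adj v v ≡ false
open Graph public

module _ {n : ℕ} (G : Graph n) where

  Adj : Fin n → Fin n → Set
  Adj u v = adj G u v ≡ true

  N : Fin n → Subset n
  N v = tabulate (adj G v)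

  degIn : Subset n → Fin n → ℕ
  degIn S v = ∣ S ∩ N v ∣

  MinDegAtLeast : Subset n → ℕ → Set
  MinDegAtLeast S g = ∀ v → v ∈ S → g ≤ degIn S v

  data Walk (S : Subset n) : Fin n → Fin n → Set where
    here : ∀ {u} → u ∈ S → Walk S u u
    step : ∀ {u w v} → u ∈ S → Adj u w → Walk S w v → Walk S u v

  InducedConnected : Subset n → Set
  InducedConnected S = ∀ u v → u ∈ S → v ∈ S → Walk S u v

  ConnectedGraph : Set
  ConnectedGraph = ∀ (u v : Fin n) → Walk Data.Fin.Subset.⊤ u v

  GoodFaulty : ℕ → Subset n → Set
  GoodFaulty g F = ∀ v → v ∉ F → g ≤ degIn (∁ F) v

  Disconnected- : Subset n → Set
  Disconnected- F = ∃[ u ] ∃[ v ] (u ∉ F × v ∉ F × ¬ Walk (∁ F) u v)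

  GoodCut : ℕ → Subset n → Set
  GoodCut g F = GoodFaulty g F × Disconnected- F

  KappaExists : ℕ → Set
  KappaExists g = ∃[ F ] GoodCut g F

  -- PMC model distinguishability
  Distinguishable : Subset n → Subset n → Set
  Distinguishable F₁ F₂ =
    ∃[ u ] ∃[ v ] (((u ∈ F₁ × u ∉ F₂) ⊎ (u ∈ F₂ × u ∉ F₁))
                   × v ∉ F₁ × v ∉ F₂ × Adj u v)

  Diagnosable : ℕ → ℕ → Set
  Diagnosable g t = ∀ F₁ F₂ → GoodFaulty g F₁ → GoodFaulty g F₂ →
    ¬ (F₁ ≡ F₂) → ∣ F₁ ∣ ≤ t → ∣ F₂ ∣ ≤ t → Distinguishable F₁ F₂

  IsComponent : Subset n → Subset n → Set
  IsComponent X C = Nonempty C × C ⊆ ∁ X × InducedConnected C ×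
    (∀ u w → u ∈ C → w ∉ X → Adj u w → w ∈ C)

  GoodPartition : ℕ → Subset n → Subset n → Subset n → Set
  GoodPartition g C A B =
    Nonempty A × Nonempty B ×
    (∀ v → v ∈ C → (v ∈ A × v ∉ B) ⊎ (v ∈ B × v ∉ A)) ×
    A ⊆ C × B ⊆ C ×
    MinDegAtLeast A g × MinDegAtLeast B g

  Splittable : ℕ → Subset n → Set
  Splittable g C = ∃[ A ] ∃[ B ] GoodPartition g C A B

  IsA : ℕ → Subset n → ℕ → Set
  IsA g C k = ∃[ A ] ∃[ B ] (GoodPartition g C A B × ∣ B ∣ ≤ ∣ A ∣ ×
    k ≡ ∣ A ∣ ×
    (∀ A′ B′ → GoodPartition g C A′ B′ → ∣ B′ ∣ ≤ ∣ A′ ∣ →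
       ∣ A ∣ ∸ ∣ B ∣ ≤ ∣ A′ ∣ ∸ ∣ B′ ∣))

  IsMin : (ℕ → Set) → ℕ → Set
  IsMin P m = P m × (∀ k → P k → m ≤ k)

  IsMax : (ℕ → Set) → ℕ → Set
  IsMax P m = P m × (∀ k → P k → k ≤ m)

  -- values in {a(C) : C splittable component of G-X} ∪ {|C| : C non-splittable
  -- component of G-X}; the minimum of this set is min{a(X), c(X)}
  -- (with min ∅ = +∞).
  ACValue : ℕ → Subset n → ℕ → Set
  ACValue g X k = ∃[ C ] (IsComponent X C ×
    ((Splittable g C × IsA g C k) ⊎ (¬ Splittable g C × k ≡ ∣ C ∣)))

  GCValue : ℕ → ℕ → Set
  GCValue g k = ∃[ X ] ∃[ m ] (GoodCut g X × IsMin (ACValue g X) m × k ≡ ∣ X ∣ + m)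

  IsGC : ℕ → ℕ → Set
  IsGC g c = IsMin (GCValue g) c

  IsTG : ℕ → ℕ → Set
  IsTG g t = IsMax (Diagnosable g) t

{-# OPTIONS --safe #-}
-- Let c^g(G) = |X| + k be attained at the g-good-neighbor cut X by a
-- component C of G − X: either k = a(C) = |A| for a balanced good partition (A , B) of C,
-- or C is not splittable, k = |C| and (A , B) = (C , ∅). Then X ∪ A and X ∪ B are
-- distinct g-good-neighbor faulty sets of size at most c^g(G), and they are
-- indistinguishable because every neighbour of C outside X lies in C = A ∪ B.
--
-- t^g(G) ≥ c − 1 for c = c^g(G) ≤ ⌈n/2⌉. Let F₁ ≠ F₂ be indistinguishable
-- g-good-neighbor faulty sets of size at most c − 1. Indistinguishability says that an
-- edge leaving F₁ △ F₂ ends in X = F₁ ∩ F₂, so the component C of G − X through a vertex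
-- of F₁ △ F₂ stays inside F₁ △ F₂ and the parts C ∩ (F₁ ∖ F₂), C ∩ (F₂ ∖ F₁) have
-- minimum degree ≥ g. Since |F₁ ∪ F₂| ≤ 2(c − 1) < n, X is a g-good-neighbor cut, and
-- min{a(X), c(X)} is at most the larger part, whence c ≤ |X| + |Fᵢ ∖ Fⱼ| ≤ |Fᵢ| ≤ c − 1.
--
-- The minima defining a(C) and min{a(X), c(X)}, and the component of a vertex, are
-- obtained classically in the double-negation monad; this suffices because every goal
-- where they are used is a contradiction or a decidable proposition.
module Submission where

open import Defs hiding (sym)
open import Level using (0ℓ)
open import Data.Bool using (Bool; true; false)
open import Data.Bool.Properties using () renaming (_≟_ to _≟ᵇ_)
open import Data.Nat using (ℕ; zero; suc; _+_; _∸_; _≤_; _<_; _⊔_; >-nonZero; ⌈_/2⌉; ⌊_/2⌋; s≤s⁻¹; _≤?_)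
open import Data.Nat.Properties
  using ( ≤-refl; ≤-reflexive; ≤-trans; <-≤-trans; ≤-<-trans; <-irrefl; <⇒≱; ≮⇒≥; ≰⇒>; <⇒≤
        ; +-comm; +-assoc; +-suc; +-identityʳ; m≤m+n; m≤n+m; +-mono-≤; +-mono-<; +-monoʳ-≤
        ; m∸n+n≡m; m∸n≡0⇒m≤n; <⇒≤pred; m≤pred[n]⇒suc[m]≤n; m≤m⊔n; m≤n⊔m; ⊔-lub; ⊔-mono-≤; +-distribˡ-⊔
        ; ⌊n/2⌋≤⌈n/2⌉; ⌊n/2⌋+⌈n/2⌉≡n; module ≤-Reasoning )
open import Data.Nat.Induction using (<-rec)
open import Data.Fin using (Fin; zero; suc)
open import Data.Fin.Properties using (any?)
open import Data.Fin.Subset using (Subset; _∈_; _∉_; _⊆_; _∩_; _∪_; ∁; ∣_∣; Nonempty; ⊥)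
open import Data.Fin.Subset.Properties
  using ( _∈?_; nonempty?; Empty-unique; ⊆-antisym; ⊥⊆; ∉⊥; ∣⊥∣≡0; ∣∁p∣≡n∸∣p∣; ∣⁅x⁆∣≡1
        ; x∈⁅y⁆⇒x≡y; p⊆q⇒∣p∣≤∣q∣; p∩q⊆p; p∩q⊆q; ∩-comm
        ; x∈p∩q⁺; x∈p∩q⁻; x∈p∪q⁺; x∈p∪q⁻; x∉p⇒x∈∁p; x∈∁p⇒x∉p; p⊆q⇒∁p⊇∁q )
open import Data.Vec using (_∷_; []; tabulate)
open import Data.Vec.Properties using (lookup∘tabulate; []=⇒lookup; lookup⇒[]=)
open import Data.Product using (∃-syntax; _×_; _,_; proj₁; proj₂; map₂)
open import Data.Sum using (_⊎_; inj₁; inj₂; [_,_]′)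
import Data.Sum as Sum
open import Data.Empty renaming (⊥ to Empty) using ()
open import Effect.Monad using (RawMonad)
open import Function using (_∘_)
open import Relation.Nullary using (¬_; Dec; yes; no; does; contradiction)
open import Relation.Nullary.Decidable
  using (_×-dec_; _⊎-dec_; ¬?; ¬¬-excluded-middle; decidable-stable; dec-true)
open import Relation.Nullary.Negation using (¬¬-Monad)
open import Relation.Binary.PropositionalEquality
  using (_≡_; _≢_; refl; sym; trans; cong; cong₂; subst; subst₂; module ≡-Reasoning)

open RawMonad (¬¬-Monad {a = 0ℓ})

¬¬-minimum : (P : ℕ → Set) {k : ℕ} → P k → ¬ ¬ (∃[ m ] P m × (∀ j → P j → m ≤ j))
¬¬-minimum P {k} = <-rec (λ k → P k → ¬ ¬ Minimum) search k
  where
  Minimum = ∃[ m ] P m × (∀ j → P j → m ≤ j)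
  search : ∀ k → (∀ {j} → j < k → P j → ¬ ¬ Minimum) → P k → ¬ ¬ Minimum
  search k rec pk = ¬¬-excluded-middle {A = ∃[ j ] j < k × P j} >>= λ where
    (yes (j , j<k , pj)) → rec j<k pj
    (no none)            → return (k , pk , λ j pj → ≮⇒≥ λ j<k → none (j , j<k , pj))

¬¬-decidable : ∀ {n} (P : Fin n → Set) → ¬ ¬ (∀ v → Dec (P v))
¬¬-decidable {zero}  P = return λ ()
¬¬-decidable {suc n} P = do
  P₀? ← ¬¬-excluded-middle
  Pₛ? ← ¬¬-decidable (P ∘ suc)
  return λ { zero → P₀? ; (suc v) → Pₛ? v }

infix 4 _∈_△_

_∈_△_ : ∀ {n} → Fin n → Subset n → Subset n → Set
v ∈ p △ q = (v ∈ p × v ∉ q) ⊎ (v ∈ q × v ∉ p)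

△-sym : ∀ {n} {v : Fin n} {p q} → v ∈ p △ q → v ∈ q △ p
△-sym = Sum.swap

△∧∈ˡ⇒∉ʳ : ∀ {n} {v : Fin n} {p q} → v ∈ p △ q → v ∈ p → v ∉ q
△∧∈ˡ⇒∉ʳ (inj₁ (_ , v∉q)) _   = v∉q
△∧∈ˡ⇒∉ʳ (inj₂ (_ , v∉p)) v∈p = contradiction v∈p v∉p

SplitsInto : ∀ {n} → Subset n → Subset n → Subset n → Set
SplitsInto C A B = ∀ v → v ∈ C → v ∈ A △ B

SplitsInto-emptyˡ : ∀ {n} {C A B : Subset n} → SplitsInto C A B → ¬ Nonempty A → C ⊆ B
SplitsInto-emptyˡ split A-empty {v} v∈C =
  [ (λ (v∈A , _) → contradiction (v , v∈A) A-empty) , proj₁ ]′ (split v v∈C)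

SplitsInto-∖ : ∀ {n} {C p q : Subset n} → SplitsInto C p q → SplitsInto C (C ∩ (p ∩ ∁ q)) (C ∩ (q ∩ ∁ p))
SplitsInto-∖ {C = C} {p} {q} split v v∈C with split v v∈C
... | inj₁ (v∈p , v∉q) = inj₁ ( x∈p∩q⁺ (v∈C , x∈p∩q⁺ (v∈p , x∉p⇒x∈∁p v∉q))
                             , λ v∈ → x∈∁p⇒x∉p (proj₂ (x∈p∩q⁻ q (∁ p) (proj₂ (x∈p∩q⁻ C _ v∈)))) v∈p )
... | inj₂ (v∈q , v∉p) = inj₂ ( x∈p∩q⁺ (v∈C , x∈p∩q⁺ (v∈q , x∉p⇒x∈∁p v∉p))
                             , λ v∈ → x∈∁p⇒x∉p (proj₂ (x∈p∩q⁻ p (∁ q) (proj₂ (x∈p∩q⁻ C _ v∈)))) v∈q )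

△⇒∉∩ : ∀ {n} {v : Fin n} {p q} → v ∈ p △ q → v ∉ p ∩ q
△⇒∉∩ {p = p} {q} (inj₁ (_ , v∉q)) v∈p∩q = v∉q (proj₂ (x∈p∩q⁻ p q v∈p∩q))
△⇒∉∩ {p = p} {q} (inj₂ (_ , v∉p)) v∈p∩q = v∉p (proj₁ (x∈p∩q⁻ p q v∈p∩q))

∉∪⇒∉△ : ∀ {n} {v : Fin n} {p q} → v ∉ p ∪ q → ¬ (v ∈ p △ q)
∉∪⇒∉△ v∉p∪q (inj₁ (v∈p , _)) = v∉p∪q (x∈p∪q⁺ (inj₁ v∈p))
∉∪⇒∉△ v∉p∪q (inj₂ (v∈q , _)) = v∉p∪q (x∈p∪q⁺ (inj₂ v∈q))

∈-tabulate⁺ : ∀ {n} (f : Fin n → Bool) {v} → f v ≡ true → v ∈ tabulate f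
∈-tabulate⁺ f {v} fv = lookup⇒[]= v (tabulate f) (trans (lookup∘tabulate f v) fv)

∈-tabulate⁻ : ∀ {n} (f : Fin n → Bool) {v} → v ∈ tabulate f → f v ≡ true
∈-tabulate⁻ f {v} v∈ = trans (sym (lookup∘tabulate f v)) ([]=⇒lookup v∈)

∈-tabulate-does⁺ : ∀ {n} {P : Fin n → Set} (P? : ∀ v → Dec (P v)) {v} →
                   P v → v ∈ tabulate (does ∘ P?)
∈-tabulate-does⁺ P? {v} pv = ∈-tabulate⁺ (does ∘ P?) (dec-true (P? v) pv)

∈-tabulate-does⁻ : ∀ {n} {P : Fin n → Set} (P? : ∀ v → Dec (P v)) {v} →
                   v ∈ tabulate (does ∘ P?) → P v
∈-tabulate-does⁻ P? {v} v∈ with P? v | ∈-tabulate⁻ (does ∘ P?) v∈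
... | yes pv | _ = pv
... | no _   | ()

≢⇒∃△ : ∀ {n} {p q : Subset n} → p ≢ q → ∃[ v ] v ∈ p △ q
≢⇒∃△ {p = p} {q} p≢q with nonempty? (p ∩ ∁ q) | nonempty? (q ∩ ∁ p)
... | yes (v , v∈) | _ = v , inj₁ (map₂ x∈∁p⇒x∉p (x∈p∩q⁻ p (∁ q) v∈))
... | no _ | yes (v , v∈) = v , inj₂ (map₂ x∈∁p⇒x∉p (x∈p∩q⁻ q (∁ p) v∈))
... | no p⊈q | no q⊈p = contradiction (⊆-antisym (⊆-from p⊈q) (⊆-from q⊈p)) p≢q
  where
  ⊆-from : ∀ {r s} → ¬ Nonempty (r ∩ ∁ s) → r ⊆ s
  ⊆-from {r} {s} r⊈s {v} v∈r with v ∈? s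
  ... | yes v∈s = v∈s
  ... | no  v∉s = contradiction (v , x∈p∩q⁺ (v∈r , x∉p⇒x∈∁p v∉s)) r⊈s

∣p∪q∣+∣p∩q∣≡∣p∣+∣q∣ : ∀ {n} (p q : Subset n) → ∣ p ∪ q ∣ + ∣ p ∩ q ∣ ≡ ∣ p ∣ + ∣ q ∣
∣p∪q∣+∣p∩q∣≡∣p∣+∣q∣ []          []          = refl
∣p∪q∣+∣p∩q∣≡∣p∣+∣q∣ (true  ∷ p) (true  ∷ q) = cong suc (begin
  ∣ p ∪ q ∣ + suc ∣ p ∩ q ∣ ≡⟨ +-suc ∣ p ∪ q ∣ ∣ p ∩ q ∣ ⟩
  suc (∣ p ∪ q ∣ + ∣ p ∩ q ∣) ≡⟨ cong suc (∣p∪q∣+∣p∩q∣≡∣p∣+∣q∣ p q) ⟩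
  suc (∣ p ∣ + ∣ q ∣)         ≡⟨ sym (+-suc ∣ p ∣ ∣ q ∣) ⟩
  ∣ p ∣ + suc ∣ q ∣           ∎)
  where open ≡-Reasoning
∣p∪q∣+∣p∩q∣≡∣p∣+∣q∣ (true  ∷ p) (false ∷ q) = cong suc (∣p∪q∣+∣p∩q∣≡∣p∣+∣q∣ p q)
∣p∪q∣+∣p∩q∣≡∣p∣+∣q∣ (false ∷ p) (true  ∷ q) =
  trans (cong suc (∣p∪q∣+∣p∩q∣≡∣p∣+∣q∣ p q)) (sym (+-suc ∣ p ∣ ∣ q ∣))
∣p∪q∣+∣p∩q∣≡∣p∣+∣q∣ (false ∷ p) (false ∷ q) = ∣p∪q∣+∣p∩q∣≡∣p∣+∣q∣ p q

∣p∪q∣≤∣p∣+∣q∣ : ∀ {n} (p q : Subset n) → ∣ p ∪ q ∣ ≤ ∣ p ∣ + ∣ q ∣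
∣p∪q∣≤∣p∣+∣q∣ p q = ≤-trans (m≤m+n ∣ p ∪ q ∣ ∣ p ∩ q ∣) (≤-reflexive (∣p∪q∣+∣p∩q∣≡∣p∣+∣q∣ p q))

split⇒∣A∣+∣B∣≡∣C∣ : ∀ {n} {C A B : Subset n} → SplitsInto C A B → A ⊆ C → B ⊆ C →
                    ∣ A ∣ + ∣ B ∣ ≡ ∣ C ∣
split⇒∣A∣+∣B∣≡∣C∣ {n} {C} {A} {B} split A⊆C B⊆C = begin
  ∣ A ∣ + ∣ B ∣         ≡⟨ sym (∣p∪q∣+∣p∩q∣≡∣p∣+∣q∣ A B) ⟩
  ∣ A ∪ B ∣ + ∣ A ∩ B ∣ ≡⟨ cong₂ (λ U I → ∣ U ∣ + ∣ I ∣) A∪B≡C (Empty-unique A∩B-empty) ⟩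
  ∣ C ∣ + ∣ ⊥ {n} ∣     ≡⟨ cong (∣ C ∣ +_) (∣⊥∣≡0 n) ⟩
  ∣ C ∣ + 0             ≡⟨ +-identityʳ ∣ C ∣ ⟩
  ∣ C ∣                 ∎
  where
  open ≡-Reasoning
  A∪B≡C : A ∪ B ≡ C
  A∪B≡C = ⊆-antisym (λ v∈ → [ A⊆C , B⊆C ]′ (x∈p∪q⁻ A B v∈))
                    (λ {v} v∈C → x∈p∪q⁺ (Sum.map proj₁ proj₁ (split v v∈C)))
  A∩B-empty : ¬ Nonempty (A ∩ B)
  A∩B-empty (v , v∈) = let v∈A , v∈B = x∈p∩q⁻ A B v∈ in △∧∈ˡ⇒∉ʳ (split v (A⊆C v∈A)) v∈A v∈B

∣p∩q∣+∣p∩∁q∣≡∣p∣ : ∀ {n} (p q : Subset n) → ∣ p ∩ q ∣ + ∣ p ∩ ∁ q ∣ ≡ ∣ p ∣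
∣p∩q∣+∣p∩∁q∣≡∣p∣ p q = split⇒∣A∣+∣B∣≡∣C∣ split (p∩q⊆p p q) (p∩q⊆p p (∁ q))
  where
  split : SplitsInto p (p ∩ q) (p ∩ ∁ q)
  split v v∈p with v ∈? q
  ... | yes v∈q = inj₁ (x∈p∩q⁺ (v∈p , v∈q) , λ v∈ → x∈∁p⇒x∉p (proj₂ (x∈p∩q⁻ p (∁ q) v∈)) v∈q)
  ... | no  v∉q = inj₂ (x∈p∩q⁺ (v∈p , x∉p⇒x∈∁p v∉q) , λ v∈ → v∉q (proj₂ (x∈p∩q⁻ p q v∈)))

∣p∩q∣+∣r∩[p∩∁q]∣≤∣p∣ : ∀ {n} (p q r : Subset n) → ∣ p ∩ q ∣ + ∣ r ∩ (p ∩ ∁ q) ∣ ≤ ∣ p ∣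
∣p∩q∣+∣r∩[p∩∁q]∣≤∣p∣ p q r = ≤-trans (+-monoʳ-≤ ∣ p ∩ q ∣ (p⊆q⇒∣p∣≤∣q∣ (p∩q⊆q r (p ∩ ∁ q))))
                                    (≤-reflexive (∣p∩q∣+∣p∩∁q∣≡∣p∣ p q))

∣p∩q∣+∣r∩[p∩∁q]∣⊔∣r∩[q∩∁p]∣≤∣p∣⊔∣q∣ : ∀ {n} (p q r : Subset n) →
  ∣ p ∩ q ∣ + (∣ r ∩ (p ∩ ∁ q) ∣ ⊔ ∣ r ∩ (q ∩ ∁ p) ∣) ≤ ∣ p ∣ ⊔ ∣ q ∣
∣p∩q∣+∣r∩[p∩∁q]∣⊔∣r∩[q∩∁p]∣≤∣p∣⊔∣q∣ p q r = begin
  ∣ p ∩ q ∣ + (∣ r ∩ (p ∩ ∁ q) ∣ ⊔ ∣ r ∩ (q ∩ ∁ p) ∣)           ≡⟨ +-distribˡ-⊔ ∣ p ∩ q ∣ _ _ ⟩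
  (∣ p ∩ q ∣ + ∣ r ∩ (p ∩ ∁ q) ∣) ⊔ (∣ p ∩ q ∣ + ∣ r ∩ (q ∩ ∁ p) ∣) ≤⟨ ⊔-mono-≤ p-side q-side ⟩
  ∣ p ∣ ⊔ ∣ q ∣                                                 ∎
  where
  open ≤-Reasoning
  p-side : ∣ p ∩ q ∣ + ∣ r ∩ (p ∩ ∁ q) ∣ ≤ ∣ p ∣
  p-side = ∣p∩q∣+∣r∩[p∩∁q]∣≤∣p∣ p q r
  q-side : ∣ p ∩ q ∣ + ∣ r ∩ (q ∩ ∁ p) ∣ ≤ ∣ q ∣
  q-side = subst (λ s → s + ∣ r ∩ (q ∩ ∁ p) ∣ ≤ ∣ q ∣) (cong ∣_∣ (∩-comm q p)) (∣p∩q∣+∣r∩[p∩∁q]∣≤∣p∣ q p r)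

Nonempty⇒∣p∣>0 : ∀ {n} {p : Subset n} → Nonempty p → 0 < ∣ p ∣
Nonempty⇒∣p∣>0 {p = p} (v , v∈p) = ≤-trans (≤-reflexive (sym (∣⁅x⁆∣≡1 v)))
  (p⊆q⇒∣p∣≤∣q∣ λ w∈ → subst (_∈ p) (sym (x∈⁅y⁆⇒x≡y v w∈)) v∈p)

∣p∣<n⇒Nonempty∁p : ∀ {n} {p : Subset n} → ∣ p ∣ < n → Nonempty (∁ p)
∣p∣<n⇒Nonempty∁p {n} {p} ∣p∣<n with nonempty? (∁ p)
... | yes ne = ne
... | no ∁p-empty = contradiction (m∸n≡0⇒m≤n n∸∣p∣≡0) (<⇒≱ ∣p∣<n)
  where
  n∸∣p∣≡0 : n ∸ ∣ p ∣ ≡ 0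
  n∸∣p∣≡0 = begin
    n ∸ ∣ p ∣   ≡⟨ sym (∣∁p∣≡n∸∣p∣ p) ⟩
    ∣ ∁ p ∣     ≡⟨ cong ∣_∣ (Empty-unique ∁p-empty) ⟩
    ∣ ⊥ {n} ∣   ≡⟨ ∣⊥∣≡0 n ⟩
    0           ∎
    where open ≡-Reasoning

⌊n/2⌋+⌊n/2⌋≤n : ∀ n → ⌊ n /2⌋ + ⌊ n /2⌋ ≤ n
⌊n/2⌋+⌊n/2⌋≤n n = ≤-trans (+-monoʳ-≤ ⌊ n /2⌋ (⌊n/2⌋≤⌈n/2⌉ n)) (≤-reflexive (⌊n/2⌋+⌈n/2⌉≡n n))

pred+pred<n : ∀ {c n} → 0 < c → c ≤ ⌈ n /2⌉ → (c ∸ 1) + (c ∸ 1) < n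
pred+pred<n {suc c} {n} _ c<⌈n/2⌉ = subst (_≤ n) (+-suc c c)
  (s≤s⁻¹ (≤-trans (+-mono-≤ c<⌈n/2⌉ c<⌈n/2⌉) (⌊n/2⌋+⌊n/2⌋≤n (suc n))))

m∸n≤o∸p⇒m≤o : ∀ {m n o p} → n ≤ m → p ≤ o → m ∸ n ≤ o ∸ p → m + n ≡ o + p → m ≤ o
m∸n≤o∸p⇒m≤o {m} {n} {o} {p} n≤m p≤o gap sum = ≮⇒≥ λ o<m →
  <-irrefl refl (<-≤-trans (+-mono-< o<m o<m) m+m≤o+o)
  where
  twice : ∀ {a b} → b ≤ a → (a ∸ b) + (a + b) ≡ a + a
  twice {a} {b} b≤a = begin
    (a ∸ b) + (a + b) ≡⟨ cong ((a ∸ b) +_) (+-comm a b) ⟩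
    (a ∸ b) + (b + a) ≡⟨ sym (+-assoc (a ∸ b) b a) ⟩
    (a ∸ b + b) + a   ≡⟨ cong (_+ a) (m∸n+n≡m b≤a) ⟩
    a + a             ∎
    where open ≡-Reasoning
  m+m≤o+o : m + m ≤ o + o
  m+m≤o+o = subst₂ _≤_ (twice n≤m) (twice p≤o) (+-mono-≤ gap (≤-reflexive sum))

module _ {n : ℕ} (G : Graph n) where

  -- Walks and components

  Adj-sym : ∀ {u v} → Adj G u v → Adj G v u
  Adj-sym {u} {v} uv = trans (Graph.sym G v u) uv

  degIn-mono : ∀ {S T v} → (∀ {w} → w ∈ S → Adj G v w → w ∈ T) → degIn G S v ≤ degIn G T v
  degIn-mono {S} {T} {v} S⇒T = p⊆q⇒∣p∣≤∣q∣ λ w∈ → let w∈S , w∈N = x∈p∩q⁻ S (N G v) w∈ in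
    x∈p∩q⁺ (S⇒T w∈S (∈-tabulate⁻ (adj G v) w∈N) , w∈N)

  source∈ : ∀ {S u v} → Walk G S u v → u ∈ S
  source∈ (here u∈S)     = u∈S
  source∈ (step u∈S _ _) = u∈S

  target∈ : ∀ {S u v} → Walk G S u v → v ∈ S
  target∈ (here v∈S)    = v∈S
  target∈ (step _ _ wv) = target∈ wv

  snoc : ∀ {S u v w} → Walk G S u v → Adj G v w → w ∈ S → Walk G S u w
  snoc (here v∈S)        vw w∈S = step v∈S vw (here w∈S)
  snoc (step u∈S uu′ wv) vw w∈S = step u∈S uu′ (snoc wv vw w∈S)

  _++ᵂ_ : ∀ {S u v w} → Walk G S u v → Walk G S v w → Walk G S u w
  here _          ++ᵂ vw = vw
  step u∈S uu′ wv ++ᵂ vw = step u∈S uu′ (wv ++ᵂ vw)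

  reverseᵂ : ∀ {S u v} → Walk G S u v → Walk G S v u
  reverseᵂ (here u∈S)        = here u∈S
  reverseᵂ (step u∈S uu′ wv) = snoc (reverseᵂ wv) (Adj-sym uu′) u∈S

  ¬¬-component : ∀ {X u} → u ∉ X → ¬ ¬ (∃[ C ] IsComponent G X C × u ∈ C)
  ¬¬-component {X} {u} u∉X = do
    reach? ← ¬¬-decidable (Walk G (∁ X) u)
    return (component reach?)
    where
    u↝u : Walk G (∁ X) u u
    u↝u = here (x∉p⇒x∈∁p u∉X)

    component : (∀ v → Dec (Walk G (∁ X) u v)) → ∃[ C ] IsComponent G X C × u ∈ C
    component reach? = C , ((u , reach⁺ u↝u) , target∈ ∘ reach⁻ , connected , closed) , reach⁺ u↝u
      where
      C : Subset n
      C = tabulate (does ∘ reach?)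
      reach⁺ : ∀ {v} → Walk G (∁ X) u v → v ∈ C
      reach⁺ = ∈-tabulate-does⁺ reach?
      reach⁻ : ∀ {v} → v ∈ C → Walk G (∁ X) u v
      reach⁻ = ∈-tabulate-does⁻ reach?
      within : ∀ {a b} → Walk G (∁ X) u a → Walk G (∁ X) a b → Walk G C a b
      within u↝a (here _)          = here (reach⁺ u↝a)
      within u↝a (step _ aa′ a′↝b) = step (reach⁺ u↝a) aa′ (within (snoc u↝a aa′ (source∈ a′↝b)) a′↝b)
      connected : InducedConnected G C
      connected a b a∈C b∈C = within (reach⁻ a∈C) (reverseᵂ (reach⁻ a∈C) ++ᵂ reach⁻ b∈C)
      closed : ∀ a w → a ∈ C → w ∉ X → Adj G a w → w ∈ C
      closed a w a∈C w∉X aw = reach⁺ (snoc (reach⁻ a∈C) aw (x∉p⇒x∈∁p w∉X))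

  -- Indistinguishable pairs from split components

  component-MinDeg : ∀ {g X C} → GoodFaulty G g X → IsComponent G X C → MinDegAtLeast G C g
  component-MinDeg gfX (_ , C⊆∁X , _ , closed) v v∈C =
    ≤-trans (gfX v (x∈∁p⇒x∉p (C⊆∁X v∈C)))
            (degIn-mono λ {w} w∈∁X vw → closed v w v∈C (x∈∁p⇒x∉p w∈∁X) vw)

  MinDegSplit : ℕ → Subset n → Subset n → Subset n → Set
  MinDegSplit g C A B =
    SplitsInto C A B × A ⊆ C × B ⊆ C × MinDegAtLeast G A g × MinDegAtLeast G B g

  MinDegSplit-sym : ∀ {g C A B} → MinDegSplit g C A B → MinDegSplit g C B A
  MinDegSplit-sym (split , A⊆C , B⊆C , mA , mB) = (λ v v∈C → △-sym (split v v∈C)) , B⊆C , A⊆C , mB , mA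

  GoodFaulty-∪ : ∀ {g X C A B} → GoodFaulty G g X → IsComponent G X C →
                 SplitsInto C A B → A ⊆ C → B ⊆ C → MinDegAtLeast G B g → GoodFaulty G g (X ∪ A)
  GoodFaulty-∪ {X = X} {C} {A} {B} gfX (_ , C⊆∁X , _ , closed) split A⊆C B⊆C mB v v∉X∪A
    with v ∈? B
  ... | yes v∈B = ≤-trans (mB v v∈B) (degIn-mono λ w∈B _ → x∉p⇒x∈∁p (B∩[X∪A]-empty w∈B))
    where
    B∩[X∪A]-empty : ∀ {w} → w ∈ B → w ∉ X ∪ A
    B∩[X∪A]-empty {w} w∈B w∈X∪A with x∈p∪q⁻ X A w∈X∪A
    ... | inj₁ w∈X = x∈∁p⇒x∉p (C⊆∁X (B⊆C w∈B)) w∈X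
    ... | inj₂ w∈A = △∧∈ˡ⇒∉ʳ (split w (A⊆C w∈A)) w∈A w∈B
  ... | no v∉B = ≤-trans (gfX v v∉X) (degIn-mono λ w∈∁X vw → x∉p⇒x∈∁p (∉X∪A w∈∁X vw))
    where
    v∉X : v ∉ X
    v∉X v∈X = v∉X∪A (x∈p∪q⁺ (inj₁ v∈X))
    v∉C : v ∉ C
    v∉C v∈C = [ (λ (v∈A , _) → v∉X∪A (x∈p∪q⁺ (inj₂ v∈A))) , (λ (v∈B , _) → v∉B v∈B) ]′ (split v v∈C)
    ∉X∪A : ∀ {w} → w ∈ ∁ X → Adj G v w → w ∉ X ∪ A
    ∉X∪A {w} w∈∁X vw w∈X∪A with x∈p∪q⁻ X A w∈X∪A
    ... | inj₁ w∈X = x∈∁p⇒x∉p w∈∁X w∈X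
    ... | inj₂ w∈A = v∉C (closed w v (A⊆C w∈A) v∉X (Adj-sym vw))

  ¬Distinguishable-∪ : ∀ {X C A B} → IsComponent G X C → SplitsInto C A B → A ⊆ C → B ⊆ C →
                       ¬ Distinguishable G (X ∪ A) (X ∪ B)
  ¬Distinguishable-∪ {X} {C} (_ , _ , _ , closed) split A⊆C B⊆C
                     (u , v , u∈△ , v∉X∪A , v∉X∪B , uv) =
    [ (λ (v∈A , _) → v∉X∪A (x∈p∪q⁺ (inj₂ v∈A))) , (λ (v∈B , _) → v∉X∪B (x∈p∪q⁺ (inj₂ v∈B))) ]′
      (split v (closed u v u∈C (λ v∈X → v∉X∪A (x∈p∪q⁺ (inj₁ v∈X))) uv))
    where
    ∈∖⇒∈ : ∀ {D E} → u ∈ X ∪ D → u ∉ X ∪ E → u ∈ D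
    ∈∖⇒∈ {D} u∈X∪D u∉X∪E = [ (λ u∈X → contradiction (x∈p∪q⁺ (inj₁ u∈X)) u∉X∪E) , (λ u∈D → u∈D) ]′
                              (x∈p∪q⁻ X D u∈X∪D)
    u∈C : u ∈ C
    u∈C = [ (λ (u∈X∪A , u∉X∪B) → A⊆C (∈∖⇒∈ u∈X∪A u∉X∪B))
          , (λ (u∈X∪B , u∉X∪A) → B⊆C (∈∖⇒∈ u∈X∪B u∉X∪A)) ]′ u∈△

  split⇒¬Diagnosable : ∀ {g t X C A B} → GoodFaulty G g X → IsComponent G X C →
    MinDegSplit g C A B → Nonempty A → ∣ B ∣ ≤ ∣ A ∣ → ∣ X ∣ + ∣ A ∣ ≤ t → ¬ Diagnosable G g t
  split⇒¬Diagnosable {X = X} {A = A} {B} gfX comp@(_ , C⊆∁X , _)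
                     ms@(split , A⊆C , B⊆C , mA , mB) (a , a∈A) ∣B∣≤∣A∣ ∣X∣+∣A∣≤t diagnosable =
    ¬Distinguishable-∪ comp split A⊆C B⊆C
      (diagnosable (X ∪ A) (X ∪ B)
        (GoodFaulty-∪ gfX comp split A⊆C B⊆C mB)
        (GoodFaulty-∪ gfX comp (proj₁ (MinDegSplit-sym ms)) B⊆C A⊆C mA)
        X∪A≢X∪B
        (≤-trans (∣p∪q∣≤∣p∣+∣q∣ X A) ∣X∣+∣A∣≤t)
        (≤-trans (∣p∪q∣≤∣p∣+∣q∣ X B) (≤-trans (+-monoʳ-≤ ∣ X ∣ ∣B∣≤∣A∣) ∣X∣+∣A∣≤t)))
    where
    X∪A≢X∪B : X ∪ A ≢ X ∪ B
    X∪A≢X∪B eq with x∈p∪q⁻ X B (subst (a ∈_) eq (x∈p∪q⁺ (inj₂ a∈A)))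
    ... | inj₁ a∈X = x∈∁p⇒x∉p (C⊆∁X (A⊆C a∈A)) a∈X
    ... | inj₂ a∈B = △∧∈ˡ⇒∉ʳ (split a (A⊆C a∈A)) a∈A a∈B

  ACValue⇒¬Diagnosable : ∀ {g t X k} → GoodFaulty G g X → ACValue G g X k →
                         ∣ X ∣ + k ≤ t → ¬ Diagnosable G g t
  ACValue⇒¬Diagnosable gfX
    (C , comp , inj₁ (_ , A , B , (neA , _ , ms) , ∣B∣≤∣A∣ , refl , _)) =
    split⇒¬Diagnosable gfX comp ms neA ∣B∣≤∣A∣
  ACValue⇒¬Diagnosable gfX (C , comp@(neC , _) , inj₂ (_ , refl)) =
    split⇒¬Diagnosable gfX comp
      ( (λ v v∈C → inj₁ (v∈C , ∉⊥)) , (λ v∈C → v∈C) , ⊥⊆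
      , component-MinDeg gfX comp , λ v v∈⊥ → contradiction v∈⊥ ∉⊥ )
      neC (p⊆q⇒∣p∣≤∣q∣ (⊥⊆ {p = C}))

  GCValue∧Diagnosable⇒< : ∀ {g c t} → GCValue G g c → Diagnosable G g t → t < c
  GCValue∧Diagnosable⇒< (_ , _ , (gfX , _) , (ac , _) , refl) diagnosable =
    ≰⇒> λ c≤t → ACValue⇒¬Diagnosable gfX ac c≤t diagnosable

  -- Bounding min{a(X), c(X)} by a split of a component

  PartitionGap : ℕ → Subset n → ℕ → Set
  PartitionGap g C d = ∃[ A ] ∃[ B ] (GoodPartition G g C A B × ∣ B ∣ ≤ ∣ A ∣ × d ≡ ∣ A ∣ ∸ ∣ B ∣)

  ¬¬IsA≤ : ∀ {g C A B} → GoodPartition G g C A B → ∣ B ∣ ≤ ∣ A ∣ →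
           ¬ ¬ (∃[ k ] IsA G g C k × k ≤ ∣ A ∣)
  ¬¬IsA≤ {g} {C} {A} {B} gp@(_ , _ , split , A⊆C , B⊆C , _) ∣B∣≤∣A∣ =
    ¬¬-minimum (PartitionGap g C) (A , B , gp , ∣B∣≤∣A∣ , refl) >>= λ where
      (_ , (A* , B* , gp*@(_ , _ , split* , A*⊆C , B*⊆C , _) , ∣B*∣≤∣A*∣ , refl) , least) →
        let gap-least : ∀ A′ B′ → GoodPartition G g C A′ B′ → ∣ B′ ∣ ≤ ∣ A′ ∣ →
                        ∣ A* ∣ ∸ ∣ B* ∣ ≤ ∣ A′ ∣ ∸ ∣ B′ ∣
            gap-least A′ B′ gp′ ∣B′∣≤∣A′∣ = least _ (A′ , B′ , gp′ , ∣B′∣≤∣A′∣ , refl)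
        in return ( ∣ A* ∣ , (A* , B* , gp* , ∣B*∣≤∣A*∣ , refl , gap-least)
                  , m∸n≤o∸p⇒m≤o ∣B*∣≤∣A*∣ ∣B∣≤∣A∣ (gap-least A B gp ∣B∣≤∣A∣)
                      (trans (split⇒∣A∣+∣B∣≡∣C∣ split* A*⊆C B*⊆C)
                             (sym (split⇒∣A∣+∣B∣≡∣C∣ split A⊆C B⊆C))))

  GoodPartition⇒¬¬ACValue≤⊔ : ∀ {g X C A B} → IsComponent G X C → GoodPartition G g C A B →
                              ¬ ¬ (∃[ k ] ACValue G g X k × k ≤ ∣ A ∣ ⊔ ∣ B ∣)
  GoodPartition⇒¬¬ACValue≤⊔ {C = C} {A} {B} comp gp@(neA , neB , ms) with ∣ B ∣ ≤? ∣ A ∣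
  ... | yes ∣B∣≤∣A∣ =
    (λ (k , a , k≤∣A∣) → k , (C , comp , inj₁ ((A , B , gp) , a)) , ≤-trans k≤∣A∣ (m≤m⊔n _ _))
    <$> ¬¬IsA≤ gp ∣B∣≤∣A∣
  ... | no  ∣B∣≰∣A∣ =
    (λ (k , a , k≤∣B∣) → k , (C , comp , inj₁ ((B , A , gp′) , a)) , ≤-trans k≤∣B∣ (m≤n⊔m _ _))
    <$> ¬¬IsA≤ gp′ (<⇒≤ (≰⇒> ∣B∣≰∣A∣))
    where
    gp′ : GoodPartition G _ C B A
    gp′ = neB , neA , MinDegSplit-sym ms

  component⇒¬¬ACValue≤∣C∣ : ∀ {g X C} → IsComponent G X C → ¬ ¬ (∃[ k ] ACValue G g X k × k ≤ ∣ C ∣)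
  component⇒¬¬ACValue≤∣C∣ {g} {C = C} comp = ¬¬-excluded-middle {A = Splittable G g C} >>= λ where
    (no unsplittable) → return (∣ C ∣ , (C , comp , inj₂ (unsplittable , refl)) , ≤-refl)
    (yes (A , B , gp@(_ , _ , _ , A⊆C , B⊆C , _))) →
      map₂ (map₂ λ k≤ → ≤-trans k≤ (⊔-lub (p⊆q⇒∣p∣≤∣q∣ A⊆C) (p⊆q⇒∣p∣≤∣q∣ B⊆C)))
      <$> GoodPartition⇒¬¬ACValue≤⊔ comp gp

  MinDegSplit⇒¬¬ACValue≤⊔ : ∀ {g X C A B} → IsComponent G X C → MinDegSplit g C A B →
                            ¬ ¬ (∃[ k ] ACValue G g X k × k ≤ ∣ A ∣ ⊔ ∣ B ∣)
  MinDegSplit⇒¬¬ACValue≤⊔ {A = A} {B} comp ms@(split , _) with nonempty? A | nonempty? B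
  ... | yes neA | yes neB = GoodPartition⇒¬¬ACValue≤⊔ comp (neA , neB , ms)
  ... | no A-empty | _ =
    map₂ (map₂ λ k≤ → ≤-trans k≤ (≤-trans (p⊆q⇒∣p∣≤∣q∣ C⊆B) (m≤n⊔m _ _)))
    <$> component⇒¬¬ACValue≤∣C∣ comp
    where C⊆B = SplitsInto-emptyˡ split A-empty
  ... | _ | no B-empty =
    map₂ (map₂ λ k≤ → ≤-trans k≤ (≤-trans (p⊆q⇒∣p∣≤∣q∣ C⊆A) (m≤m⊔n _ _)))
    <$> component⇒¬¬ACValue≤∣C∣ comp
    where C⊆A = SplitsInto-emptyˡ (proj₁ (MinDegSplit-sym ms)) B-empty

  ACValue⇒>0 : ∀ {g X k} → ACValue G g X k → 0 < k
  ACValue⇒>0 (_ , _ , inj₁ (_ , _ , _ , (neA , _) , _ , refl , _)) = Nonempty⇒∣p∣>0 neA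
  ACValue⇒>0 (_ , (neC , _) , inj₂ (_ , refl))                      = Nonempty⇒∣p∣>0 neC

  GCValue⇒>0 : ∀ {g c} → GCValue G g c → 0 < c
  GCValue⇒>0 (X , m , _ , (ac , _) , refl) = ≤-trans (ACValue⇒>0 ac) (m≤n+m m ∣ X ∣)

  IsGC⇒¬¬≤ : ∀ {g c X k} → IsGC G g c → GoodCut G g X → ACValue G g X k → ¬ ¬ (c ≤ ∣ X ∣ + k)
  IsGC⇒¬¬≤ {g} {X = X} (_ , c-least) cut ac = do
    (m , m-least) ← ¬¬-minimum (ACValue G g X) ac
    return (≤-trans (c-least _ (X , m , cut , m-least , refl)) (+-monoʳ-≤ ∣ X ∣ (proj₂ m-least _ ac)))

  -- Indistinguishable pairs of faulty sets

  Distinguishable? : ∀ F₁ F₂ → Dec (Distinguishable G F₁ F₂)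
  Distinguishable? F₁ F₂ = any? λ u → any? λ v →
    (((u ∈? F₁) ×-dec ¬? (u ∈? F₂)) ⊎-dec ((u ∈? F₂) ×-dec ¬? (u ∈? F₁))) ×-dec
    ¬? (v ∈? F₁) ×-dec ¬? (v ∈? F₂) ×-dec (adj G u v ≟ᵇ true)

  Distinguishable-sym : ∀ {F₁ F₂} → Distinguishable G F₁ F₂ → Distinguishable G F₂ F₁
  Distinguishable-sym (u , v , u∈△ , v∉F₁ , v∉F₂ , uv) = u , v , △-sym u∈△ , v∉F₂ , v∉F₁ , uv

  GoodFaulty-∩ : ∀ {g F₁ F₂} → GoodFaulty G g F₁ → GoodFaulty G g F₂ → GoodFaulty G g (F₁ ∩ F₂)
  GoodFaulty-∩ {F₁ = F₁} {F₂} gf₁ gf₂ v v∉F₁∩F₂ with v ∈? F₁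
  ... | no  v∉F₁ = ≤-trans (gf₁ v v∉F₁) (degIn-mono λ w∈ _ → p⊆q⇒∁p⊇∁q (p∩q⊆p F₁ F₂) w∈)
  ... | yes v∈F₁ = ≤-trans (gf₂ v (λ v∈F₂ → v∉F₁∩F₂ (x∈p∩q⁺ (v∈F₁ , v∈F₂))))
                           (degIn-mono λ w∈ _ → p⊆q⇒∁p⊇∁q (p∩q⊆q F₁ F₂) w∈)

  module _ {F₁ F₂ : Subset n} (indist : ¬ Distinguishable G F₁ F₂) where

    ¬Distinguishable⇒walk-in-△ : ∀ {S a b} → S ⊆ ∁ (F₁ ∩ F₂) → Walk G S a b →
                                 a ∈ F₁ △ F₂ → b ∈ F₁ △ F₂
    ¬Distinguishable⇒walk-in-△ S⊆ (here _) a∈△ = a∈△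
    ¬Distinguishable⇒walk-in-△ {a = a} S⊆ (step {w = w} _ aw w↝b) a∈△ =
      ¬Distinguishable⇒walk-in-△ S⊆ w↝b w∈△
      where
      w∈△ : w ∈ F₁ △ F₂
      w∈△ with w ∈? F₁ | w ∈? F₂
      ... | yes w∈F₁ | yes w∈F₂ = contradiction (x∈p∩q⁺ (w∈F₁ , w∈F₂)) (x∈∁p⇒x∉p (S⊆ (source∈ w↝b)))
      ... | yes w∈F₁ | no  w∉F₂ = inj₁ (w∈F₁ , w∉F₂)
      ... | no  w∉F₁ | yes w∈F₂ = inj₂ (w∈F₂ , w∉F₁)
      ... | no  w∉F₁ | no  w∉F₂ = contradiction (a , w , a∈△ , w∉F₁ , w∉F₂ , aw) indist

    ¬Distinguishable⇒MinDeg : ∀ {g X C} → X ⊆ F₂ → GoodFaulty G g F₂ → IsComponent G X C →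
                              MinDegAtLeast G (C ∩ (F₁ ∩ ∁ F₂)) g
    ¬Distinguishable⇒MinDeg {C = C} X⊆F₂ gf₂ (_ , _ , _ , closed) v v∈ =
      ≤-trans (gf₂ v v∉F₂) (degIn-mono neighbour∈)
      where
      v∈C = proj₁ (x∈p∩q⁻ C _ v∈)
      v∈F₁ = proj₁ (x∈p∩q⁻ F₁ (∁ F₂) (proj₂ (x∈p∩q⁻ C _ v∈)))
      v∉F₂ = x∈∁p⇒x∉p (proj₂ (x∈p∩q⁻ F₁ (∁ F₂) (proj₂ (x∈p∩q⁻ C _ v∈))))
      neighbour∈ : ∀ {w} → w ∈ ∁ F₂ → Adj G v w → w ∈ C ∩ (F₁ ∩ ∁ F₂)
      neighbour∈ {w} w∈∁F₂ vw with w ∈? F₁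
      ... | no  w∉F₁ = contradiction (v , w , inj₁ (v∈F₁ , v∉F₂) , w∉F₁ , x∈∁p⇒x∉p w∈∁F₂ , vw) indist
      ... | yes w∈F₁ = x∈p∩q⁺ (closed v w v∈C (x∈∁p⇒x∉p w∈∁F₂ ∘ X⊆F₂) vw , x∈p∩q⁺ (w∈F₁ , w∈∁F₂))

    ¬Distinguishable⇒GoodCut : ∀ {g u z} → GoodFaulty G g F₁ → GoodFaulty G g F₂ →
                               u ∈ F₁ △ F₂ → z ∉ F₁ ∪ F₂ → GoodCut G g (F₁ ∩ F₂)
    ¬Distinguishable⇒GoodCut {u = u} {z} gf₁ gf₂ u∈△ z∉F₁∪F₂ =
      GoodFaulty-∩ gf₁ gf₂ ,
      u , z , △⇒∉∩ u∈△ , (λ z∈X → z∉F₁∪F₂ (x∈p∪q⁺ (inj₁ (proj₁ (x∈p∩q⁻ F₁ F₂ z∈X))))) ,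
      λ u↝z → ∉∪⇒∉△ z∉F₁∪F₂ (¬Distinguishable⇒walk-in-△ (λ z∈ → z∈) u↝z u∈△)

  ¬Distinguishable⇒MinDegSplit : ∀ {g F₁ F₂ C u} → ¬ Distinguishable G F₁ F₂ →
    GoodFaulty G g F₁ → GoodFaulty G g F₂ → IsComponent G (F₁ ∩ F₂) C → u ∈ C → u ∈ F₁ △ F₂ →
    MinDegSplit g C (C ∩ (F₁ ∩ ∁ F₂)) (C ∩ (F₂ ∩ ∁ F₁))
  ¬Distinguishable⇒MinDegSplit {F₁ = F₁} {F₂} {u = u} indist gf₁ gf₂
                               comp@(_ , C⊆∁X , connected , _) u∈C u∈△ =
    SplitsInto-∖ (λ v v∈C → ¬Distinguishable⇒walk-in-△ indist C⊆∁X (connected u v u∈C v∈C) u∈△) ,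
    p∩q⊆p _ _ , p∩q⊆p _ _ ,
    ¬Distinguishable⇒MinDeg indist (p∩q⊆q F₁ F₂) gf₂ comp ,
    ¬Distinguishable⇒MinDeg (indist ∘ Distinguishable-sym) (p∩q⊆p F₁ F₂) gf₁ comp

  IsGC⇒Diagnosable : ∀ {g c} → IsGC G g c → c ≤ ⌈ n /2⌉ → Diagnosable G g (c ∸ 1)
  IsGC⇒Diagnosable {c = c} isgc@(gc , _) c≤⌈n/2⌉ F₁ F₂ gf₁ gf₂ F₁≢F₂ ∣F₁∣≤pred[c] ∣F₂∣≤pred[c] =
    decidable-stable (Distinguishable? F₁ F₂) λ indist → refute indist (λ absurd → absurd)
    where
    X = F₁ ∩ F₂
    c>0 = GCValue⇒>0 gc
    u∈△ = proj₂ (≢⇒∃△ F₁≢F₂)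
    outside-F₁∪F₂ : Nonempty (∁ (F₁ ∪ F₂))
    outside-F₁∪F₂ = ∣p∣<n⇒Nonempty∁p (≤-<-trans (∣p∪q∣≤∣p∣+∣q∣ F₁ F₂)
      (≤-<-trans (+-mono-≤ ∣F₁∣≤pred[c] ∣F₂∣≤pred[c]) (pred+pred<n c>0 c≤⌈n/2⌉)))
    z∉F₁∪F₂ = x∈∁p⇒x∉p (proj₂ outside-F₁∪F₂)

    ∣X∣+k≤pred[c] : ∀ {C k} → k ≤ ∣ C ∩ (F₁ ∩ ∁ F₂) ∣ ⊔ ∣ C ∩ (F₂ ∩ ∁ F₁) ∣ → ∣ X ∣ + k ≤ c ∸ 1
    ∣X∣+k≤pred[c] {C} k≤ = ≤-trans (+-monoʳ-≤ ∣ X ∣ k≤)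
      (≤-trans (∣p∩q∣+∣r∩[p∩∁q]∣⊔∣r∩[q∩∁p]∣≤∣p∣⊔∣q∣ F₁ F₂ C) (⊔-lub ∣F₁∣≤pred[c] ∣F₂∣≤pred[c]))

    refute : ¬ Distinguishable G F₁ F₂ → ¬ ¬ Empty
    refute indist = do
      (C , comp , u∈C) ← ¬¬-component (△⇒∉∩ u∈△)
      (k , ac , k≤) ← MinDegSplit⇒¬¬ACValue≤⊔ comp
                        (¬Distinguishable⇒MinDegSplit indist gf₁ gf₂ comp u∈C u∈△)
      c≤∣X∣+k ← IsGC⇒¬¬≤ isgc (¬Distinguishable⇒GoodCut indist gf₁ gf₂ u∈△ z∉F₁∪F₂) ac
      return (<⇒≱ (m≤pred[n]⇒suc[m]≤n {{>-nonZero c>0}} (∣X∣+k≤pred[c] {C} k≤)) c≤∣X∣+k)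

theorem4p2 : ∀ (n : ℕ) (G : Graph n) (g : ℕ) → ConnectedGraph G →
    KappaExists G g → ∀ (c : ℕ) → IsGC G g c → c ≤ ⌈ n /2⌉ →
    IsTG G g (c ∸ 1)
theorem4p2 n G g _ _ c isgc@(gc , _) c≤⌈n/2⌉ =
  IsGC⇒Diagnosable G isgc c≤⌈n/2⌉ ,
  λ t diagnosable → <⇒≤pred (GCValue∧Diagnosable⇒< G gc diagnosable)
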